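{- Let $n\in\mathbb{Z}^+$ and let $\alpha=(a_1,\dots,a_n)$ be a unit interval parking function of length $n$. Then the number of lucky cars of $\alpha$ equals the number of blocks in the block structure of $\alpha$.
   Context: A parking preference $(a_1,\dots,a_n)\in[n]^n$ describes $n$ cars entering a one-way street with spots $1,\dots,n$ in the order $1,2,\dots,n$; car $i$ parks in the first unoccupied spot numbered $\ge a_i$. It is a parking function if all cars park. It is a unit interval parking function if it is a parking function and every car $i$ parks in spot $a_i$ or spot $a_i+1$. Car $i$ is lucky if it parks in spot $a_i$. Block structure: let $\alpha^{\uparrow}=(a_1',\dots,a_n')$ be the weakly increasing rearrangement of $\alpha$. The indices $i$ with $a_i'=i$ are the block starts; the block structure $\alpha'=\pi_1|\pi_2|\cdots|\pi_k$ cuts $\alpha^{\uparrow}$ into consecutive segments, each beginning at a block start and running up to just before the next block start (or to the end). The segments $\pi_1,\dots,\pi_k$ are the blocks. -}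

module Defs where

open import Data.Nat using (ℕ; zero; suc; _≤_; _<_; _+_; _≤ᵇ_; _≡ᵇ_)
open import Data.Nat.Properties using (_≟_; _≤?_; _<?_)
open import Data.Bool using (Bool; true; false; if_then_else_)
open import Data.List using (List; []; _∷_; length; _++_; [_]; reverse)
open import Data.List.Membership.Propositional using (_∈_)
open import Data.List.Membership.DecPropositional _≟_ using (_∈?_)
open import Data.List.Relation.Unary.All using (All)
open import Data.Vec using (Vec; toList)
open import Data.Fin using (Fin; toℕ)
open import Data.Maybe using (Maybe; just; nothing)
open import Data.Product using (_×_; _,_; Σ; ∃)
open import Relation.Nullary using (does; ¬_)
open import Relation.Binary.PropositionalEquality using (_≡_)

-- Conventions: spots and preferences are 1-indexed natural numbers;
-- a parking preference of length n is a Vec ℕ n whose entries lie in [1,n].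

IsPreference : {n : ℕ} → Vec ℕ n → Set
IsPreference {n} α = All (λ a → 1 ≤ a × a ≤ n) (toList α)

firstFree : (n : ℕ) → List ℕ → (a : ℕ) → (fuel : ℕ) → Maybe ℕ
firstFree n occ a zero = nothing
firstFree n occ a (suc fuel) =
  if does (a ≤? n)
    then (if does (a ∈? occ) then firstFree n occ (suc a) fuel else just a)
    else nothing

parkFrom : (n : ℕ) → List ℕ → List ℕ → Maybe (List ℕ)
parkFrom n occ [] = just []
parkFrom n occ (a ∷ as) with firstFree n occ a (suc n)
... | nothing = nothing
... | just s with parkFrom n (s ∷ occ) as
...   | nothing = nothing
...   | just ss = just (s ∷ ss)

outcome : {n : ℕ} → Vec ℕ n → Maybe (List ℕ)
outcome {n} α = parkFrom n [] (toList α)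

IsParkingFunction : {n : ℕ} → Vec ℕ n → Set
IsParkingFunction α = IsPreference α × ∃ λ ps → outcome α ≡ just ps

data Pointwise (R : ℕ → ℕ → Set) : List ℕ → List ℕ → Set where
  []  : Pointwise R [] []
  _∷_ : ∀ {a s as ss} → R a s → Pointwise R as ss → Pointwise R (a ∷ as) (s ∷ ss)

UnitOrLucky : ℕ → ℕ → Set
UnitOrLucky a s = (s ≡ a) Data.Sum.⊎ (s ≡ suc a)
  where import Data.Sum

IsUnitIntervalPF : {n : ℕ} → Vec ℕ n → Set
IsUnitIntervalPF α =
  IsPreference α × ∃ λ ps → (outcome α ≡ just ps) × Pointwise UnitOrLucky (toList α) ps

countEq : List ℕ → List ℕ → ℕ
countEq (a ∷ as) (s ∷ ss) = (if does (a ≟ s) then 1 else 0) + countEq as ss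
countEq _ _ = 0

luckyCount : {n : ℕ} → Vec ℕ n → ℕ
luckyCount α with outcome α
... | nothing = 0
... | just ps = countEq (toList α) ps

insert : ℕ → List ℕ → List ℕ
insert x [] = x ∷ []
insert x (y ∷ ys) = if does (x ≤? y) then x ∷ y ∷ ys else y ∷ insert x ys

sortℕ : List ℕ → List ℕ
sortℕ [] = []
sortℕ (x ∷ xs) = insert x (sortℕ xs)

-- Block structure: cut the sorted list (indexed from i) into consecutive
-- segments, a new segment starting exactly at each index i with a'_i = i.
-- 'cur' is the (reversed) segment under construction.
cutFrom : ℕ → List ℕ → List ℕ → List (List ℕ)
cutFrom i cur [] = close cur
  where
  close : List ℕ → List (List ℕ)
  close [] = []
  close c  = reverse c ∷ []
cutFrom i cur (x ∷ xs) with does (x ≟ i)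
... | true  = close cur ++ cutFrom (suc i) (x ∷ []) xs
  where
  close : List ℕ → List (List ℕ)
  close [] = []
  close c  = reverse c ∷ []
... | false = cutFrom (suc i) (x ∷ cur) xs

blockStructure : {n : ℕ} → Vec ℕ n → List (List ℕ)
blockStructure α = cutFrom 1 [] (sortℕ (toList α))

numBlocks : {n : ℕ} → Vec ℕ n → ℕ
numBlocks α = length (blockStructure α)

module Submission where

-- Every car parks in p_i ∈ {a_i, a_i + 1}, so Σ a_i + n = Σ p_i + #lucky, and the
-- spots p_i are a permutation of 1 … n.  Cars preferring a spot ≤ v park in [1, v + 1]
-- and the others in (v, n], so v ≤ #{i | a_i ≤ v} ≤ v + 1; for the sorted preferences
-- a'_i this forces a'_i ∈ {i - 1, i}.  Hence the same identity holds for (a', 1 … n),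
-- whose "lucky" indices a'_i = i are exactly the block starts, and comparing the two
-- identities gives #lucky = #blocks.

open import Defs
open import Data.Nat using (ℕ; zero; suc; _+_; _≤_; _<_; _≤ᵇ_; _≡ᵇ_; z≤n; s≤s)
open import Data.Nat.Properties
open import Data.Nat.ListAction using (sum)
open import Data.Nat.ListAction.Properties using (sum-↭)
open import Data.Nat.Tactic.RingSolver using (solve-∀)
open import Data.Bool using (true; false; if_then_else_)
open import Data.List using (List; []; _∷_; length; _++_; [_]; filter)
open import Data.List.Properties using (length-++; filter-accept; filter-none)
open import Data.List.Membership.Propositional using (_∈_; _∉_)
open import Data.List.Membership.Propositional.Properties using (∈-∃++; ∈-++⁻; ∈-++⁺ˡ; ∈-++⁺ʳ)
open import Data.List.Membership.DecPropositional _≟_ using (_∈?_)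
open import Data.List.Relation.Unary.All as All using (All; []; _∷_)
open import Data.List.Relation.Unary.All.Properties using (all-filter) renaming (filter⁺ to All-filter⁺)
open import Data.List.Relation.Unary.Any using (here; there)
open import Data.List.Relation.Unary.AllPairs using (AllPairs; []; _∷_)
open import Data.List.Relation.Unary.Unique.Propositional using (Unique)
import Data.List.Relation.Unary.Unique.Propositional.Properties as Unique
open import Data.List.Relation.Binary.Subset.Propositional using (_⊆_)
open import Data.List.Relation.Binary.Permutation.Propositional using (_↭_; refl; prep; swap; ↭-sym; ↭-trans)
open import Data.List.Relation.Binary.Permutation.Propositional.Properties
  using (shift; ↭-length; filter-↭; All-resp-↭; ++-identityʳ)
open import Data.Vec using (Vec; toList)
open import Data.Vec.Properties using (length-toList)
open import Data.Maybe using (just; nothing)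
open import Data.Product using (∃; _×_; _,_; proj₁; proj₂)
open import Data.Sum using (inj₁; inj₂)
open import Function using (_∘_)
open import Relation.Nullary using (¬_; yes; no; does; proof; contradiction)
open import Relation.Nullary.Reflects using (ofʸ; ofⁿ)
open import Relation.Unary using (Pred; Decidable)
open import Relation.Unary.Properties using (∁?)
open import Relation.Binary.PropositionalEquality
  using (_≡_; _≢_; refl; sym; trans; cong; cong₂; subst; ≢-sym; module ≡-Reasoning)

module _ {a} {A : Set a} where

  ∈-remove : ∀ {x y : A} xs {ys} → y ∈ xs ++ [ x ] ++ ys → y ≢ x → y ∈ xs ++ ys
  ∈-remove xs y∈ y≢x with ∈-++⁻ xs y∈
  ... | inj₁ y∈xs         = ∈-++⁺ˡ y∈xs
  ... | inj₂ (here y≡x)   = contradiction y≡x y≢x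
  ... | inj₂ (there y∈ys) = ∈-++⁺ʳ xs y∈ys

  unique-⊆⇒++-↭ : ∀ {xs ys : List A} → Unique xs → xs ⊆ ys → ∃ λ zs → xs ++ zs ↭ ys
  unique-⊆⇒++-↭ {ys = ys} [] _ = ys , refl
  unique-⊆⇒++-↭ {x ∷ xs} (x∉xs ∷ xs-unique) xs⊆ys
    with us , vs , refl ← ∈-∃++ (xs⊆ys (here refl)) =
    let zs , xs++zs↭ = unique-⊆⇒++-↭ xs-unique xs⊆us++vs
    in  zs , ↭-trans (prep x xs++zs↭) (↭-sym (shift x us vs))
    where
    xs⊆us++vs : xs ⊆ us ++ vs
    xs⊆us++vs y∈xs = ∈-remove us (xs⊆ys (there y∈xs)) (≢-sym (All.lookup x∉xs y∈xs))

  unique-⊆⇒length≤ : ∀ {xs ys : List A} → Unique xs → xs ⊆ ys → length xs ≤ length ys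
  unique-⊆⇒length≤ {xs} {ys} xs-unique xs⊆ys
    with zs , xs++zs↭ys ← unique-⊆⇒++-↭ xs-unique xs⊆ys = begin
      length xs              ≤⟨ m≤m+n (length xs) (length zs) ⟩
      length xs + length zs  ≡⟨ length-++ xs ⟨
      length (xs ++ zs)      ≡⟨ ↭-length xs++zs↭ys ⟩
      length ys              ∎
    where open ≤-Reasoning

  unique-⊆-length≡⇒↭ : ∀ {xs ys : List A} → Unique xs → xs ⊆ ys →
                       length xs ≡ length ys → xs ↭ ys
  unique-⊆-length≡⇒↭ {xs} xs-unique xs⊆ys same-length
    with unique-⊆⇒++-↭ xs-unique xs⊆ys
  ... | [] , xs++[]↭ys = ↭-trans (↭-sym (++-identityʳ xs)) xs++[]↭ys
  ... | z ∷ zs , xs++zs↭ys = contradiction too-long (m+1+n≢m (length xs))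
    where
    too-long : length xs + suc (length zs) ≡ length xs
    too-long = trans (sym (length-++ xs)) (trans (↭-length xs++zs↭ys) (sym same-length))

interval : ℕ → ℕ → List ℕ
interval i zero    = []
interval i (suc k) = suc i ∷ interval (suc i) k

length-interval : ∀ i k → length (interval i k) ≡ k
length-interval i zero    = refl
length-interval i (suc k) = cong suc (length-interval (suc i) k)

∈-interval⁺ : ∀ {i s} k → i < s → s ≤ i + k → s ∈ interval i k
∈-interval⁺ {i} zero i<s s≤i+0 = contradiction (subst (_ ≤_) (+-identityʳ i) s≤i+0) (<⇒≱ i<s)
∈-interval⁺ {i} {s} (suc k) i<s s≤i+1+k with suc i ≟ s
... | yes refl = here refl
... | no 1+i≢s = there (∈-interval⁺ k (≤∧≢⇒< i<s 1+i≢s) (subst (s ≤_) (+-suc i k) s≤i+1+k))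

unique-bounded⇒length≤ : ∀ {i k xs} → Unique xs → All (λ s → i < s × s ≤ i + k) xs → length xs ≤ k
unique-bounded⇒length≤ {i} {k} xs-unique bounded =
  subst (_ ≤_) (length-interval i k)
    (unique-⊆⇒length≤ xs-unique (λ s∈xs → let i<s , s≤i+k = All.lookup bounded s∈xs
                                          in  ∈-interval⁺ k i<s s≤i+k))

length-filter+length-filter-∁ : ∀ {a p} {A : Set a} {P : Pred A p} (P? : Decidable P) xs →
  length (filter P? xs) + length (filter (∁? P?) xs) ≡ length xs
length-filter+length-filter-∁ P? [] = refl
length-filter+length-filter-∁ P? (x ∷ xs) with P? x
... | yes _ = cong suc (length-filter+length-filter-∁ P? xs)
... | no _  = trans (+-suc _ _) (cong suc (length-filter+length-filter-∁ P? xs))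

Pointwise-length : ∀ {R as ps} → Pointwise R as ps → length as ≡ length ps
Pointwise-length []       = refl
Pointwise-length (_ ∷ rs) = cong suc (Pointwise-length rs)

Pointwise-All : ∀ {R : ℕ → ℕ → Set} {P Q : ℕ → Set} {as ps} →
  (∀ {a s} → R a s → P a → Q s) → Pointwise R as ps → All P as → All Q ps
Pointwise-All R⇒ []       []         = []
Pointwise-All R⇒ (r ∷ rs) (pa ∷ pas) = R⇒ r pa ∷ Pointwise-All R⇒ rs pas

length-filter-Pointwise : ∀ {R : ℕ → ℕ → Set} {P Q : ℕ → Set} (P? : Decidable P) (Q? : Decidable Q) →
  (∀ {a s} → R a s → P a → Q s) →
  ∀ {as ps} → Pointwise R as ps → length (filter P? as) ≤ length (filter Q? ps)
length-filter-Pointwise P? Q? R⇒ [] = z≤n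
length-filter-Pointwise P? Q? R⇒ (_∷_ {a} {s} r rs)
  with ih ← length-filter-Pointwise P? Q? R⇒ rs | P? a | Q? s
... | yes _  | yes _  = s≤s ih
... | yes pa | no ¬qs = contradiction (R⇒ r pa) ¬qs
... | no _   | yes _  = m≤n⇒m≤1+n ih
... | no _   | no _   = ih

-- does (m ≤? n) and does (m ≟ n) compute to m ≤ᵇ n and m ≡ᵇ n, so case splits
-- abstract over these booleans, paired with the reflecting proof.
firstFree-unoccupied : ∀ n occ a fuel {s} → firstFree n occ a fuel ≡ just s → s ∉ occ × s ≤ n
firstFree-unoccupied n occ a zero ()
firstFree-unoccupied n occ a (suc fuel) found with a ≤ᵇ n | proof (a ≤? n) | found
... | false | _       | ()
... | true  | ofʸ a≤n | found′ with a ∈? occ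
...   | yes _   = firstFree-unoccupied n occ (suc a) fuel found′
...   | no a∉occ with refl ← found′ = a∉occ , a≤n

parkFrom-spots : ∀ n occ as {ss} → parkFrom n occ as ≡ just ss →
  Unique ss × All (_∉ occ) ss × All (_≤ n) ss
parkFrom-spots n occ []       refl = [] , [] , []
parkFrom-spots n occ (a ∷ as) parked with firstFree n occ a (suc n) in free | parked
... | nothing | ()
... | just s  | parked′ with parkFrom n (s ∷ occ) as in rest | parked′
...   | nothing | ()
...   | just ss | refl
  with ss-unique , ss∉s∷occ , ss≤n ← parkFrom-spots n (s ∷ occ) as rest
     | s∉occ , s≤n ← firstFree-unoccupied n occ a (suc n) free =
  All.map (λ t∉s∷occ s≡t → t∉s∷occ (here (sym s≡t))) ss∉s∷occ ∷ ss-unique ,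
  s∉occ ∷ All.map (_∘ there) ss∉s∷occ ,
  s≤n ∷ ss≤n

luckyCount-outcome : ∀ {n} (α : Vec ℕ n) {ps} → outcome α ≡ just ps → luckyCount α ≡ countEq (toList α) ps
luckyCount-outcome α parked rewrite parked = refl

UnitOrLucky⇒bounds : ∀ {a s} → UnitOrLucky a s → a ≤ s × s ≤ suc a
UnitOrLucky⇒bounds {a} (inj₁ refl) = ≤-refl , n≤1+n a
UnitOrLucky⇒bounds {a} (inj₂ refl) = n≤1+n a , ≤-refl

bounds⇒UnitOrLucky : ∀ {a s} → a ≤ s → s ≤ suc a → UnitOrLucky a s
bounds⇒UnitOrLucky a≤s s≤1+a with m≤n⇒m<n∨m≡n a≤s
... | inj₁ a<s = inj₂ (≤-antisym s≤1+a a<s)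
... | inj₂ a≡s = inj₁ (sym a≡s)

unitOrLucky-excess : ∀ {a s} → UnitOrLucky a s → suc a ≡ s + (if does (a ≟ s) then 1 else 0)
unitOrLucky-excess {a} {s} r with a ≡ᵇ s | proof (a ≟ s) | r
... | true  | ofʸ refl | _         = +-comm 1 a
... | false | ofⁿ a≢s  | inj₁ refl = contradiction refl a≢s
... | false | ofⁿ _    | inj₂ refl = sym (+-identityʳ (suc a))

sum+length≡sum+countEq : ∀ {as ps} → Pointwise UnitOrLucky as ps →
  sum as + length as ≡ sum ps + countEq as ps
sum+length≡sum+countEq [] = refl
sum+length≡sum+countEq (_∷_ {a} {s} {as} {ps} r rs) = begin
  (a + sum as) + suc (length as)        ≡⟨ regroupˡ a (sum as) (length as) ⟩
  suc a + (sum as + length as)          ≡⟨ cong₂ _+_ (unitOrLucky-excess r) (sum+length≡sum+countEq rs) ⟩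
  (s + lucky) + (sum ps + countEq as ps) ≡⟨ regroupʳ s lucky (sum ps) (countEq as ps) ⟩
  (s + sum ps) + (lucky + countEq as ps) ∎
  where
  open ≡-Reasoning
  lucky = if does (a ≟ s) then 1 else 0
  regroupˡ : ∀ a S L → (a + S) + suc L ≡ suc a + (S + L)
  regroupˡ = solve-∀
  regroupʳ : ∀ s e S C → (s + e) + (S + C) ≡ (s + S) + (e + C)
  regroupʳ = solve-∀

countEq-↭ : ∀ {as ps bs qs} → Pointwise UnitOrLucky as ps → Pointwise UnitOrLucky bs qs →
  as ↭ bs → ps ↭ qs → countEq as ps ≡ countEq bs qs
countEq-↭ {as} {ps} {bs} {qs} as~ps bs~qs as↭bs ps↭qs = +-cancelˡ-≡ (sum ps) _ _ (begin
  sum ps + countEq as ps  ≡⟨ sum+length≡sum+countEq as~ps ⟨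
  sum as + length as      ≡⟨ cong₂ _+_ (sum-↭ as↭bs) (↭-length as↭bs) ⟩
  sum bs + length bs      ≡⟨ sum+length≡sum+countEq bs~qs ⟩
  sum qs + countEq bs qs  ≡⟨ cong (_+ countEq bs qs) (sum-↭ ps↭qs) ⟨
  sum ps + countEq bs qs  ∎)
  where open ≡-Reasoning

insert-↭ : ∀ x xs → insert x xs ↭ x ∷ xs
insert-↭ x []       = refl
insert-↭ x (y ∷ ys) with x ≤ᵇ y
... | true  = refl
... | false = ↭-trans (prep y (insert-↭ x ys)) (swap y x refl)

sortℕ-↭ : ∀ xs → sortℕ xs ↭ xs
sortℕ-↭ []       = refl
sortℕ-↭ (x ∷ xs) = ↭-trans (insert-↭ x (sortℕ xs)) (prep x (sortℕ-↭ xs))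

insert-sorted : ∀ x {xs} → AllPairs _≤_ xs → AllPairs _≤_ (insert x xs)
insert-sorted x {[]}     [] = [] ∷ []
insert-sorted x {y ∷ ys} (y≤ys ∷ ys-sorted) with x ≤ᵇ y | proof (x ≤? y)
... | true  | ofʸ x≤y = (x≤y ∷ All.map (≤-trans x≤y) y≤ys) ∷ y≤ys ∷ ys-sorted
... | false | ofⁿ x≰y =
  All-resp-↭ (↭-sym (insert-↭ x ys)) (<⇒≤ (≰⇒> x≰y) ∷ y≤ys) ∷ insert-sorted x ys-sorted

sortℕ-sorted : ∀ xs → AllPairs _≤_ (sortℕ xs)
sortℕ-sorted []       = []
sortℕ-sorted (x ∷ xs) = insert-sorted x (sortℕ-sorted xs)

count≤ : ℕ → List ℕ → ℕ
count≤ v xs = length (filter (_≤? v) xs)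

count≤-∷ : ∀ v x xs → count≤ v (x ∷ xs) ≤ suc (count≤ v xs)
count≤-∷ v x xs with x ≤ᵇ v
... | true  = ≤-refl
... | false = n≤1+n _

count≤-accept : ∀ {v x} xs → x ≤ v → count≤ v (x ∷ xs) ≡ suc (count≤ v xs)
count≤-accept {v} xs x≤v = cong length (filter-accept (_≤? v) x≤v)

count≤-↭ : ∀ v {xs ys} → xs ↭ ys → count≤ v xs ≡ count≤ v ys
count≤-↭ v xs↭ys = ↭-length (filter-↭ (_≤? v) xs↭ys)

sorted-count≤-pos⇒head≤ : ∀ {v x xs} → All (x ≤_) xs → 0 < count≤ v (x ∷ xs) → x ≤ v
sorted-count≤-pos⇒head≤ {v} {x} x≤xs pos with x ≤? v
... | yes x≤v = x≤v
... | no x≰v  = contradiction (subst (0 <_) (cong length (filter-none (_≤? v) none)) pos) (λ ())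
  where
  none : All (λ y → ¬ y ≤ v) (x ∷ _)
  none = x≰v ∷ All.map (λ x≤y y≤v → x≰v (≤-trans x≤y y≤v)) x≤xs

module _ {as ps} (cars : Pointwise UnitOrLucky as ps) (ps-unique : Unique ps) where

  count≤-upper : All (0 <_) ps → ∀ v → count≤ v as ≤ suc v
  count≤-upper ps-positive v = ≤-trans
    (length-filter-Pointwise (_≤? v) (_≤? suc v)
      (λ r a≤v → ≤-trans (proj₂ (UnitOrLucky⇒bounds r)) (s≤s a≤v)) cars)
    (unique-bounded⇒length≤ {0} (Unique.filter⁺ (_≤? suc v) ps-unique)
      (All.zip (All-filter⁺ (_≤? suc v) ps-positive , all-filter (_≤? suc v) ps)))

  count≤-lower : ∀ v k → All (_≤ v + k) ps → length as ≡ v + k → v ≤ count≤ v as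
  count≤-lower v k ps≤v+k length-as = +-cancelʳ-≤ late v (count≤ v as) (begin
    v + late           ≤⟨ +-monoʳ-≤ v late≤k ⟩
    v + k              ≡⟨ length-as ⟨
    length as          ≡⟨ length-filter+length-filter-∁ (_≤? v) as ⟨
    count≤ v as + late ∎)
    where
    open ≤-Reasoning
    late = length (filter (∁? (_≤? v)) as)
    late≤k : late ≤ k
    late≤k = ≤-trans
      (length-filter-Pointwise (∁? (_≤? v)) (v <?_)
        (λ r a≰v → <-≤-trans (≰⇒> a≰v) (proj₁ (UnitOrLucky⇒bounds r))) cars)
      (unique-bounded⇒length≤ (Unique.filter⁺ (v <?_) ps-unique)
        (All.zip (all-filter (v <?_) ps , All-filter⁺ (v <?_) ps≤v+k)))

-- xs is the suffix of a sorted list after its first i entries, which the summand i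
-- accounts for in the bounds v ≤ #{y ≤ v} ≤ v + 1 on the whole list.
sorted⇒UnitOrLucky : ∀ i {xs} → AllPairs _≤_ xs →
  (∀ v k → v + k ≡ i + length xs → v ≤ i + count≤ v xs) →
  All (λ y → i + count≤ y xs ≤ suc y) xs →
  Pointwise UnitOrLucky xs (interval i (length xs))
sorted⇒UnitOrLucky i {[]}     []                 _     _               = []
sorted⇒UnitOrLucky i {x ∷ xs} (x≤xs ∷ xs-sorted) lower (upper-x ∷ upper) =
  bounds⇒UnitOrLucky x≤1+i 1+i≤1+x ∷ sorted⇒UnitOrLucky (suc i) xs-sorted lower′ upper′
  where
  x≤1+i : x ≤ suc i
  x≤1+i = sorted-count≤-pos⇒head≤ x≤xs
    (+-cancelˡ-< i 0 _ (subst (_< i + count≤ (suc i) (x ∷ xs)) (sym (+-identityʳ i))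
      (lower (suc i) (length xs) (sym (+-suc i (length xs))))))
  1+i≤1+x : suc i ≤ suc x
  1+i≤1+x = ≤-trans (s≤s (m≤m+n i (count≤ x xs)))
    (subst (_≤ suc x) (trans (cong (i +_) (count≤-accept xs ≤-refl)) (+-suc i _)) upper-x)
  lower′ : ∀ v k → v + k ≡ suc i + length xs → v ≤ suc i + count≤ v xs
  lower′ v k v+k≡ = ≤-trans (lower v k (trans v+k≡ (sym (+-suc i (length xs)))))
    (≤-trans (+-monoʳ-≤ i (count≤-∷ v x xs)) (≤-reflexive (+-suc i _)))
  upper′ : All (λ y → suc i + count≤ y xs ≤ suc y) xs
  upper′ = All.zipWith
    (λ {y} (x≤y , bound) → subst (_≤ suc y) (trans (cong (i +_) (count≤-accept xs x≤y)) (+-suc i _)) bound)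
    (x≤xs , upper)

length-cutFrom : ∀ i c cs xs →
  length (cutFrom (suc i) (c ∷ cs) xs) ≡ suc (countEq xs (interval i (length xs)))
length-cutFrom i c cs []       = refl
length-cutFrom i c cs (x ∷ xs) with x ≡ᵇ suc i
... | true  = cong suc (length-cutFrom (suc i) x [] xs)
... | false = length-cutFrom (suc i) x (c ∷ cs) xs

length-cutFrom-UnitOrLucky : ∀ {xs} → All (1 ≤_) xs → Pointwise UnitOrLucky xs (interval 0 (length xs)) →
  length (cutFrom 1 [] xs) ≡ countEq xs (interval 0 (length xs))
length-cutFrom-UnitOrLucky {[]}     []         []      = refl
length-cutFrom-UnitOrLucky {x ∷ xs} (1≤x ∷ _) (r ∷ _)
  with refl ← ≤-antisym (proj₁ (UnitOrLucky⇒bounds r)) 1≤x = length-cutFrom 1 1 [] xs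

theorem3p2 : (n : ℕ) → (α : Vec ℕ (suc n)) → IsUnitIntervalPF α →
    luckyCount α ≡ numBlocks α
theorem3p2 n α (preference , ps , parked , cars) = begin
  luckyCount α                       ≡⟨ luckyCount-outcome α parked ⟩
  countEq as ps                      ≡⟨ countEq-↭ cars sorted-cars (↭-sym (sortℕ-↭ as)) ps↭interval ⟩
  countEq sorted (interval 0 L)      ≡⟨ length-cutFrom-UnitOrLucky sorted-positive sorted-cars ⟨
  numBlocks α                        ∎
  where
  open ≡-Reasoning
  as = toList α
  sorted = sortℕ as
  L = length sorted
  length-as : length as ≡ L
  length-as = ↭-length (↭-sym (sortℕ-↭ as))
  ps-unique = proj₁ (parkFrom-spots (suc n) [] as parked)
  ps≤L : All (_≤ L) ps
  ps≤L = subst (λ m → All (_≤ m) ps) (trans (sym (length-toList α)) length-as)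
    (proj₂ (proj₂ (parkFrom-spots (suc n) [] as parked)))
  ps-positive : All (0 <_) ps
  ps-positive = Pointwise-All (λ r 1≤a → ≤-trans 1≤a (proj₁ (UnitOrLucky⇒bounds r))) cars
    (All.map proj₁ preference)
  sorted-positive : All (1 ≤_) sorted
  sorted-positive = All-resp-↭ (↭-sym (sortℕ-↭ as)) (All.map proj₁ preference)
  ps↭interval : ps ↭ interval 0 L
  ps↭interval = unique-⊆-length≡⇒↭ ps-unique
    (λ s∈ps → ∈-interval⁺ L (All.lookup ps-positive s∈ps) (All.lookup ps≤L s∈ps))
    (trans (trans (sym (Pointwise-length cars)) length-as) (sym (length-interval 0 L)))
  sorted-cars : Pointwise UnitOrLucky sorted (interval 0 L)
  sorted-cars = sorted⇒UnitOrLucky 0 (sortℕ-sorted as)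
    (λ v k v+k≡L → subst (v ≤_) (sym (count≤-↭ v (sortℕ-↭ as)))
      (count≤-lower cars ps-unique v k (subst (λ m → All (_≤ m) ps) (sym v+k≡L) ps≤L)
        (trans length-as (sym v+k≡L))))
    (All.universal (λ y → subst (_≤ suc y) (sym (count≤-↭ y (sortℕ-↭ as)))
      (count≤-upper cars ps-unique ps-positive y)) sorted)
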